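{- Let $G$ be a finite graph with maximum independent set size $\alpha$. For $0\le k\le\alpha$ let $\mathcal{I}_k$ be the set of independent sets of size $k$ in $G$ and $i_k=|\mathcal{I}_k|$. For an independent set $I$, let $e(I)$ be the number of vertices of $G$ that are neither in $I$ nor adjacent to any vertex of $I$, and for $0\le k\le \alpha-1$ let $$e_k=\frac{\sum_{I\in\mathcal{I}_k}e(I)}{i_k}.$$ Then the sequence $(i_k)_{k=0}^{\alpha}$ is ordered log-concave if and only if the sequence $(e_k)_{k=0}^{\alpha-1}$ is weakly decreasing.
   Context: A sequence $(a_0,\ldots,a_m)$ of positive terms is ordered log-concave if $a_k^2\ge\left(1+\frac1k\right)a_{k-1}a_{k+1}$ for $k=1,\ldots,m-1$. An independent set is a set of mutually non-adjacent vertices; $e(I)$ equals the number of ways to extend $I$ to an independent set of size $|I|+1$. -}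

module Defs where

open import Data.Bool using (Bool; true; false; _∧_; not; if_then_else_)
open import Data.Nat using (ℕ; zero; suc; _+_; _*_; _⊔_; _≤_; _<_)
open import Data.Fin using (Fin)
open import Data.Fin.Subset using (Subset; inside; outside; ∣_∣)
open import Data.Vec using (Vec; []; _∷_; lookup)
open import Data.List using (List; []; _∷_; map; _++_; filter; length; foldr; allFin)
open import Data.Nat.ListAction using (sum)
open import Data.Bool.ListAction using (all; any)
open import Data.Integer using (+_)
open import Data.Rational using (ℚ; 0ℚ; 1ℚ; _/_) renaming (_≤_ to _≤ℚ_; _+_ to _+ℚ_; _*_ to _*ℚ_)
open import Data.Nat.Properties using (_≟_)
open import Relation.Binary.PropositionalEquality using (_≡_)
open import Relation.Nullary.Decidable using (⌊_⌋)
open import Data.Product using (_×_)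

record Graph (n : ℕ) : Set where
  field
    adj    : Fin n → Fin n → Bool
    sym    : ∀ u v → adj u v ≡ adj v u
    irrefl : ∀ v → adj v v ≡ false
open Graph public

_∈ᵇ_ : ∀ {n} → Fin n → Subset n → Bool
v ∈ᵇ I with lookup I v
... | inside  = true
... | outside = false

allSubsets : (n : ℕ) → List (Subset n)
allSubsets zero    = [] ∷ []
allSubsets (suc n) = map (outside ∷_) (allSubsets n) ++ map (inside ∷_) (allSubsets n)

isIndependent : ∀ {n} → Graph n → Subset n → Bool
isIndependent {n} G I =
  all (λ u → all (λ v → not ((u ∈ᵇ I) ∧ (v ∈ᵇ I) ∧ adj G u v)) (allFin n)) (allFin n)

independentSets : ∀ {n} → Graph n → List (Subset n)
independentSets G = filter (λ I → isIndependent G I ≟ᵇ true) (allSubsets _)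
  where
  open import Data.Bool.Properties renaming (_≟_ to _≟ᵇ_)

indSetsOfSize : ∀ {n} → Graph n → ℕ → List (Subset n)
indSetsOfSize G k = filter (λ I → ∣ I ∣ ≟ k) (independentSets G)

indCount : ∀ {n} → Graph n → ℕ → ℕ
indCount G k = length (indSetsOfSize G k)

independenceNumber : ∀ {n} → Graph n → ℕ
independenceNumber G = foldr (λ I m → ∣ I ∣ ⊔ m) 0 (independentSets G)

ext : ∀ {n} → Graph n → Subset n → ℕ
ext {n} G I =
  length (filter (λ v → (not (v ∈ᵇ I) ∧ not (any (λ u → (u ∈ᵇ I) ∧ adj G u v) (allFin n))) ≟ᵇ true)
                 (allFin n))
  where
  open import Data.Bool.Properties renaming (_≟_ to _≟ᵇ_)

-- a / b as a rational number (only used with b > 0; b = 0 gives 0).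
ratio : ℕ → ℕ → ℚ
ratio a zero    = 0ℚ
ratio a (suc b) = + a / suc b

eAvg : ∀ {n} → Graph n → ℕ → ℚ
eAvg G k = ratio (sum (map (ext G) (indSetsOfSize G k))) (indCount G k)

-- (a_0,…,a_m) is ordered log-concave: all terms positive and
-- a_k² ≥ (1 + 1/k) a_{k-1} a_{k+1} for k = 1,…,m-1  (here k = suc j).
OrderedLogConcave : (ℕ → ℕ) → ℕ → Set
OrderedLogConcave a m =
  (∀ k → k ≤ m → 0 < a k) ×
  (∀ j → suc j < m →
     (1ℚ +ℚ (+ 1 / suc j)) *ℚ ((+ a j / 1) *ℚ (+ a (suc (suc j)) / 1))
       ≤ℚ (+ a (suc j) / 1) *ℚ (+ a (suc j) / 1))

WeaklyDecreasing : (ℕ → ℚ) → ℕ → Set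
WeaklyDecreasing b m = ∀ k → suc k ≤ m → b (suc k) ≤ℚ b k

{-# OPTIONS --safe #-}
module Submission where

-- Double counting: the pairs (I, v) with I ∈ 𝓘_k and v a vertex extending I correspond, via
-- (I, v) ↦ (I ∪ {v}, v), to the pairs (J, v) with J ∈ 𝓘_{k+1} and v ∈ J.  Hence
-- Σ_{I ∈ 𝓘_k} e(I) = (k+1) i_{k+1}, i.e. e_k = (k+1) i_{k+1} / i_k.  Every i_k with k ≤ α is
-- positive (subsets of independent sets are independent), so e_{k+1} ≤ e_k is equivalent to
-- (k+2) i_k i_{k+2} ≤ (k+1) i_{k+1}², which is ordered log-concavity at k+1 with the
-- denominators cleared.

open import Algebra.Bundles using (CommutativeMonoid)
open import Data.Bool using (Bool; true; false; _∧_; not; T)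
import Data.Bool.Properties as Bool
open import Data.Bool.ListAction using (all; any)
open import Data.Empty using (⊥-elim)
open import Data.Fin using (Fin; zero; suc)
import Data.Fin.Properties as Fin
open import Data.Fin.Subset using (Subset; inside; outside; ∣_∣; _∈_; _⊆_; ⊥)
open import Data.Fin.Subset.Properties using (s⊆s; ⊥⊆; ∣⊥∣≡0; ∉⊥)
open import Data.Integer using (+_; +≤+)
import Data.Integer as ℤ
import Data.Integer.Properties as ℤ
open import Data.List using (List; []; _∷_; map; _++_; filter; length; foldr; allFin)
open import Data.List.Membership.Propositional using (lose) renaming (_∈_ to _∈ˡ_)
open import Data.List.Membership.Propositional.Properties
  using (∈-allFin; ∈-map⁺; ∈-++⁺ˡ; ∈-++⁺ʳ; ∈-filter⁺; ∈-filter⁻)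
open import Data.List.Properties using (map-cong; map-++; map-∘; map-tabulate; filter-some)
import Data.List.Relation.Unary.All as All
open import Data.List.Relation.Unary.All.Properties using (all⁺; all⁻; tabulate⁺)
open import Data.List.Relation.Unary.Any using (here; there; satisfied)
open import Data.List.Relation.Unary.Any.Properties using (any⁺; any⁻)
open import Data.Nat using (ℕ; zero; suc; _+_; _*_; _∸_; _≤_; _<_; _⊔_; _≡ᵇ_; z≤n; s≤s; NonZero)
import Data.Nat.Properties as ℕ
open import Data.Nat.ListAction using (sum)
open import Data.Nat.ListAction.Properties using (sum-++)
open import Data.Nat.Solver using (module +-*-Solver)
open import Data.Product using (_×_; _,_; proj₂; ∃-syntax)
open import Data.Product.Function.NonDependent.Propositional using (_×-cong_)
import Data.Rational as ℚ
open import Data.Rational using (1ℚ; _/_; toℚᵘ)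
import Data.Rational.Properties as ℚ
import Data.Rational.Unnormalised as ℚᵘ
open import Data.Rational.Unnormalised using (mkℚᵘ; *≤*)
import Data.Rational.Unnormalised.Properties as ℚᵘ
open import Data.Sum using (_⊎_; inj₁; inj₂)
open import Data.Unit using (tt)
open import Data.Vec using ([]; _∷_; _[_]≔_; here; there)
open import Data.Vec.Properties using ([]≔-minimal)
open import Function using (_∘_)
open import Function.Bundles using (_⇔_; mk⇔; Equivalence)
open import Function.Properties.Equivalence using () renaming (sym to ⇔-sym)
import Function.Related.Propositional as Related
open import Relation.Binary.PropositionalEquality
  using (_≡_; _≢_; refl; sym; trans; cong; cong₂; subst; subst₂; module ≡-Reasoning)
open import Relation.Nullary using (¬_; Dec; does; yes; no)

open import Defs hiding (sym)

open Equivalence using (to; from)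
open import Algebra.Properties.CommutativeSemigroup
  (CommutativeMonoid.commutativeSemigroup Bool.∧-commutativeMonoid) using (x∙yz≈y∙xz; xy∙z≈xz∙y)
open import Algebra.Properties.CommutativeSemigroup ℕ.+-commutativeSemigroup using (interchange)

private variable
  A B : Set

∑ : List A → (A → ℕ) → ℕ
∑ xs f = sum (map f xs)

syntax ∑ xs (λ x → e) = ∑[ x ∈ xs ] e

[_] : Bool → ℕ
[ true ]  = 1
[ false ] = 0

[∧] : ∀ b c → [ b ∧ c ] ≡ [ b ] * [ c ]
[∧] true  c = sym (ℕ.+-identityʳ [ c ])
[∧] false c = refl

∑-cong : ∀ xs {f g : A → ℕ} → (∀ x → f x ≡ g x) → ∑ xs f ≡ ∑ xs g
∑-cong xs f≗g = cong sum (map-cong f≗g xs)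

∑-++ : ∀ xs ys (f : A → ℕ) → ∑ (xs ++ ys) f ≡ ∑ xs f + ∑ ys f
∑-++ xs ys f = trans (cong sum (map-++ f xs ys)) (sum-++ (map f xs) (map f ys))

∑-map : ∀ (g : B → A) xs (f : A → ℕ) → ∑ (map g xs) f ≡ ∑ xs (f ∘ g)
∑-map g xs f = cong sum (sym (map-∘ xs))

∑-zero : ∀ (xs : List A) → ∑[ x ∈ xs ] 0 ≡ 0
∑-zero []       = refl
∑-zero (x ∷ xs) = ∑-zero xs

∑-+ : ∀ xs (f g : A → ℕ) → ∑[ x ∈ xs ] (f x + g x) ≡ ∑ xs f + ∑ xs g
∑-+ []       f g = refl
∑-+ (x ∷ xs) f g = trans (cong (_+_ (f x + g x)) (∑-+ xs f g)) (interchange (f x) (g x) (∑ xs f) (∑ xs g))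

∑-*ˡ : ∀ c xs (f : A → ℕ) → c * ∑ xs f ≡ ∑[ x ∈ xs ] (c * f x)
∑-*ˡ c []       f = ℕ.*-zeroʳ c
∑-*ˡ c (x ∷ xs) f = trans (ℕ.*-distribˡ-+ c (f x) (∑ xs f)) (cong (_+_ (c * f x)) (∑-*ˡ c xs f))

∑-comm : ∀ xs (ys : List B) (f : A → B → ℕ) →
         ∑[ x ∈ xs ] ∑[ y ∈ ys ] f x y ≡ ∑[ y ∈ ys ] ∑[ x ∈ xs ] f x y
∑-comm []       ys f = sym (∑-zero ys)
∑-comm (x ∷ xs) ys f = trans (cong (_+_ (∑ ys (f x))) (∑-comm xs ys f)) (sym (∑-+ ys (f x) _))

∑-filter : ∀ {P : A → Set} (P? : ∀ x → Dec (P x)) xs (f : A → ℕ) →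
           ∑ (filter P? xs) f ≡ ∑[ x ∈ xs ] ([ does (P? x) ] * f x)
∑-filter P? []       f = refl
∑-filter P? (x ∷ xs) f with does (P? x)
... | true  = cong₂ _+_ (sym (ℕ.*-identityˡ (f x))) (∑-filter P? xs f)
... | false = ∑-filter P? xs f

length≡∑ : ∀ (xs : List A) → length xs ≡ ∑[ x ∈ xs ] 1
length≡∑ []       = refl
length≡∑ (x ∷ xs) = cong suc (length≡∑ xs)

≤-foldr-⊔⁻ : ∀ (f : A → ℕ) xs {k} → k ≤ foldr (λ x m → f x ⊔ m) 0 xs →
             k ≡ 0 ⊎ ∃[ x ] x ∈ˡ xs × k ≤ f x
≤-foldr-⊔⁻ f []       k≤0 = inj₁ (ℕ.n≤0⇒n≡0 k≤0)
≤-foldr-⊔⁻ f (x ∷ xs) k≤ with ℕ.⊔-sel (f x) (foldr (λ x m → f x ⊔ m) 0 xs)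
... | inj₁ eq = inj₂ (x , here refl , subst (_ ≤_) eq k≤)
... | inj₂ eq with ≤-foldr-⊔⁻ f xs (subst (_ ≤_) eq k≤)
...   | inj₁ k≡0            = inj₁ k≡0
...   | inj₂ (y , y∈ , k≤y) = inj₂ (y , there y∈ , k≤y)

∑-allFin-suc : ∀ {n} (f : Fin (suc n) → ℕ) → ∑ (allFin (suc n)) f ≡ f zero + ∑ (allFin n) (f ∘ suc)
∑-allFin-suc f = cong (λ xs → f zero + sum xs) (trans (map-tabulate suc f) (sym (map-tabulate (λ i → i) (f ∘ suc))))

does-≟-true : ∀ b → does (b Bool.≟ true) ≡ b
does-≟-true true  = refl
does-≟-true false = refl

T-injective : ∀ {x y} → T x ⇔ T y → x ≡ y
T-injective {true}  {true}  _      = refl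
T-injective {true}  {false} tx⇔ty = ⊥-elim (to tx⇔ty tt)
T-injective {false} {true}  tx⇔ty = ⊥-elim (from tx⇔ty tt)
T-injective {false} {false} _      = refl

T-not⇔¬T : ∀ {b} → T (not b) ⇔ (¬ T b)
T-not⇔¬T {true}  = mk⇔ (λ ()) (λ ¬t → ¬t tt)
T-not⇔¬T {false} = mk⇔ (λ _ ()) (λ _ → tt)

T-not-∧∧ : ∀ {a b c} → T (not (a ∧ b ∧ c)) ⇔ (T a → T b → c ≡ false)
T-not-∧∧ {true}  {true}  {true}  = mk⇔ (λ ()) (λ f → subst T (f tt tt) tt)
T-not-∧∧ {true}  {true}  {false} = mk⇔ (λ _ _ _ → refl) (λ _ → tt)
T-not-∧∧ {true}  {false}         = mk⇔ (λ _ _ ()) (λ _ → tt)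
T-not-∧∧ {false}                 = mk⇔ (λ _ ()) (λ _ → tt)

T-all-allFin : ∀ {n} (p : Fin n → Bool) → T (all p (allFin n)) ⇔ (∀ v → T (p v))
T-all-allFin p = mk⇔ (λ all-p v → All.lookup (all⁺ p _ all-p) (∈-allFin v)) (λ p-all → all⁻ p (tabulate⁺ p-all))

∑-allSubsets-suc : ∀ {n} (f : Subset (suc n) → ℕ) →
  ∑ (allSubsets (suc n)) f ≡ ∑ (allSubsets n) (f ∘ (outside ∷_)) + ∑ (allSubsets n) (f ∘ (inside ∷_))
∑-allSubsets-suc {n} f = trans (∑-++ (map (outside ∷_) (allSubsets n)) _ f)
  (cong₂ _+_ (∑-map (outside ∷_) (allSubsets n) f) (∑-map (inside ∷_) (allSubsets n) f))

∈-allSubsets : ∀ {n} (S : Subset n) → S ∈ˡ allSubsets n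
∈-allSubsets []            = here refl
∈-allSubsets (outside ∷ S) = ∈-++⁺ˡ (∈-map⁺ (outside ∷_) (∈-allSubsets S))
∈-allSubsets (inside ∷ S)  = ∈-++⁺ʳ _ (∈-map⁺ (inside ∷_) (∈-allSubsets S))

-- Removing v is a bijection from the subsets containing v onto those avoiding it.
∑-removal : ∀ {n} (v : Fin n) (R : Subset n → Bool) →
  ∑[ S ∈ allSubsets n ] [ not (v ∈ᵇ S) ∧ R S ] ≡ ∑[ S ∈ allSubsets n ] [ v ∈ᵇ S ∧ R (S [ v ]≔ outside) ]
∑-removal {suc n} zero R = begin
  ∑[ S ∈ allSubsets (suc n) ] [ not (zero ∈ᵇ S) ∧ R S ]
    ≡⟨ ∑-allSubsets-suc (λ S → [ not (zero ∈ᵇ S) ∧ R S ]) ⟩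
  avoiding + none
    ≡⟨ ℕ.+-comm avoiding none ⟩
  none + avoiding
    ≡⟨ ∑-allSubsets-suc (λ S → [ zero ∈ᵇ S ∧ R (S [ zero ]≔ outside) ]) ⟨
  ∑[ S ∈ allSubsets (suc n) ] [ zero ∈ᵇ S ∧ R (S [ zero ]≔ outside) ] ∎
  where
  open ≡-Reasoning
  avoiding none : ℕ
  avoiding = ∑[ S ∈ allSubsets n ] [ R (outside ∷ S) ]
  none     = ∑[ S ∈ allSubsets n ] 0
∑-removal {suc n} (suc v) R = begin
  ∑[ S ∈ allSubsets (suc n) ] [ not (suc v ∈ᵇ S) ∧ R S ]
    ≡⟨ ∑-allSubsets-suc (λ S → [ not (suc v ∈ᵇ S) ∧ R S ]) ⟩
  ∑[ S ∈ allSubsets n ] [ not (v ∈ᵇ S) ∧ R (outside ∷ S) ]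
    + ∑[ S ∈ allSubsets n ] [ not (v ∈ᵇ S) ∧ R (inside ∷ S) ]
    ≡⟨ cong₂ _+_ (∑-removal v (R ∘ (outside ∷_))) (∑-removal v (R ∘ (inside ∷_))) ⟩
  ∑[ S ∈ allSubsets n ] [ v ∈ᵇ S ∧ R (outside ∷ S [ v ]≔ outside) ]
    + ∑[ S ∈ allSubsets n ] [ v ∈ᵇ S ∧ R (inside ∷ S [ v ]≔ outside) ]
    ≡⟨ ∑-allSubsets-suc (λ S → [ suc v ∈ᵇ S ∧ R (S [ suc v ]≔ outside) ]) ⟨
  ∑[ S ∈ allSubsets (suc n) ] [ suc v ∈ᵇ S ∧ R (S [ suc v ]≔ outside) ] ∎
  where open ≡-Reasoning

∣∣≡∑ : ∀ {n} (S : Subset n) → ∣ S ∣ ≡ ∑[ v ∈ allFin n ] [ v ∈ᵇ S ]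
∣∣≡∑ []            = refl
∣∣≡∑ (outside ∷ S) = trans (∣∣≡∑ S) (sym (∑-allFin-suc (λ v → [ v ∈ᵇ (outside ∷ S) ])))
∣∣≡∑ (inside ∷ S)  = trans (cong suc (∣∣≡∑ S)) (sym (∑-allFin-suc (λ v → [ v ∈ᵇ (inside ∷ S) ])))

∣∣-removal : ∀ {n} {v : Fin n} {S : Subset n} → v ∈ S → ∣ S ∣ ≡ suc ∣ S [ v ]≔ outside ∣
∣∣-removal                      here        = refl
∣∣-removal {S = inside ∷ _}  (there v∈S) = cong suc (∣∣-removal v∈S)
∣∣-removal {S = outside ∷ _} (there v∈S) = ∣∣-removal v∈S

∈-removal⁺ : ∀ {n} {u v : Fin n} {S : Subset n} → u ≢ v → u ∈ S → u ∈ S [ v ]≔ outside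
∈-removal⁺ {S = S} u≢v u∈S = []≔-minimal S _ _ u≢v u∈S

∈-removal⁻ : ∀ {n} {u v : Fin n} {S : Subset n} → u ∈ S [ v ]≔ outside → u ≢ v × u ∈ S
∈-removal⁻ {u = suc u} {zero}  {_ ∷ S} (there u∈S)  = (λ ()) , there u∈S
∈-removal⁻ {u = zero}  {suc v} {_ ∷ S} here         = (λ ()) , here
∈-removal⁻ {u = suc u} {suc v} {_ ∷ S} (there u∈S⁻) with ∈-removal⁻ {S = S} u∈S⁻
... | u≢v , u∈S = (λ eq → u≢v (Fin.suc-injective eq)) , there u∈S

∈ᵇ⇔∈ : ∀ {n} {v : Fin n} {S : Subset n} → T (v ∈ᵇ S) ⇔ v ∈ S
∈ᵇ⇔∈ = mk⇔ to′ from′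
  where
  to′ : ∀ {n} {v : Fin n} {S : Subset n} → T (v ∈ᵇ S) → v ∈ S
  to′ {v = zero}  {inside ∷ S} _   = here
  to′ {v = suc v} {_ ∷ S}      v∈S = there (to′ v∈S)
  from′ : ∀ {n} {v : Fin n} {S : Subset n} → v ∈ S → T (v ∈ᵇ S)
  from′ here        = tt
  from′ (there v∈S) = from′ v∈S

⊆-ofSize : ∀ {n} k (S : Subset n) → k ≤ ∣ S ∣ → ∃[ S′ ] S′ ⊆ S × ∣ S′ ∣ ≡ k
⊆-ofSize {n} zero S _ = ⊥ , ⊥⊆ , ∣⊥∣≡0 n
⊆-ofSize (suc k) (outside ∷ S) k<∣S∣ with ⊆-ofSize (suc k) S k<∣S∣
... | S′ , S′⊆S , ∣S′∣≡k = outside ∷ S′ , s⊆s S′⊆S , ∣S′∣≡k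
⊆-ofSize (suc k) (inside ∷ S)  (s≤s k≤∣S∣) with ⊆-ofSize k S k≤∣S∣
... | S′ , S′⊆S , ∣S′∣≡k = inside ∷ S′ , s⊆s S′⊆S , cong suc ∣S′∣≡k

-- A rational literal + a / suc b is by definition the normal form of mkℚᵘ (+ a) b.
private
  toℚᵘ-/ : ∀ a b → toℚᵘ (+ a / suc b) ℚᵘ.≃ mkℚᵘ (+ a) b
  toℚᵘ-/ a b = ℚ.toℚᵘ-fromℚᵘ (mkℚᵘ (+ a) b)

/-*-/ : ∀ a c m n .{{_ : NonZero m}} .{{_ : NonZero n}} →
        (+ a / m) ℚ.* (+ c / n) ≡ (+ (a * c) / (m * n)) {{ℕ.m*n≢0 m n}}
/-*-/ a c (suc b) (suc d) = ℚ.toℚᵘ-injective (begin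
  toℚᵘ ((+ a / suc b) ℚ.* (+ c / suc d))         ≈⟨ ℚ.toℚᵘ-homo-* (+ a / suc b) (+ c / suc d) ⟩
  toℚᵘ (+ a / suc b) ℚᵘ.* toℚᵘ (+ c / suc d)     ≈⟨ ℚᵘ.*-cong (toℚᵘ-/ a b) (toℚᵘ-/ c d) ⟩
  mkℚᵘ (+ a ℤ.* + c) (d + b * suc d)             ≡⟨ cong (λ z → mkℚᵘ z (d + b * suc d)) (ℤ.pos-* a c) ⟨
  mkℚᵘ (+ (a * c)) (d + b * suc d)               ≈⟨ toℚᵘ-/ (a * c) (d + b * suc d) ⟨
  toℚᵘ (+ (a * c) / (suc b * suc d))             ∎)
  where open ℚᵘ.≃-Reasoning

/-+-/ : ∀ a c m n .{{_ : NonZero m}} .{{_ : NonZero n}} →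
        (+ a / m) ℚ.+ (+ c / n) ≡ (+ (a * n + c * m) / (m * n)) {{ℕ.m*n≢0 m n}}
/-+-/ a c (suc b) (suc d) = ℚ.toℚᵘ-injective (begin
  toℚᵘ ((+ a / suc b) ℚ.+ (+ c / suc d))               ≈⟨ ℚ.toℚᵘ-homo-+ (+ a / suc b) (+ c / suc d) ⟩
  toℚᵘ (+ a / suc b) ℚᵘ.+ toℚᵘ (+ c / suc d)           ≈⟨ ℚᵘ.+-cong (toℚᵘ-/ a b) (toℚᵘ-/ c d) ⟩
  mkℚᵘ (+ a ℤ.* + suc d ℤ.+ + c ℤ.* + suc b) (d + b * suc d) ≡⟨ cong (λ z → mkℚᵘ z (d + b * suc d)) numerator ⟨
  mkℚᵘ (+ (a * suc d + c * suc b)) (d + b * suc d)     ≈⟨ toℚᵘ-/ (a * suc d + c * suc b) (d + b * suc d) ⟨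
  toℚᵘ (+ (a * suc d + c * suc b) / (suc b * suc d))   ∎)
  where
  open ℚᵘ.≃-Reasoning
  numerator : + (a * suc d + c * suc b) ≡ + a ℤ.* + suc d ℤ.+ + c ℤ.* + suc b
  numerator = trans (ℤ.pos-+ (a * suc d) (c * suc b)) (cong₂ ℤ._+_ (ℤ.pos-* a (suc d)) (ℤ.pos-* c (suc b)))

/-≤-/ : ∀ a c m n .{{_ : NonZero m}} .{{_ : NonZero n}} → (+ a / m ℚ.≤ + c / n) ⇔ (a * n ≤ c * m)
/-≤-/ a c (suc b) (suc d) = mk⇔ (crossMultiply ∘ unnormalise) (normalise ∘ uncross)
  where
  unnormalise : + a / suc b ℚ.≤ + c / suc d → mkℚᵘ (+ a) b ℚᵘ.≤ mkℚᵘ (+ c) d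
  unnormalise p≤q = ℚᵘ.≤-respʳ-≃ (toℚᵘ-/ c d) (ℚᵘ.≤-respˡ-≃ (toℚᵘ-/ a b) (ℚ.toℚᵘ-mono-≤ p≤q))
  normalise : mkℚᵘ (+ a) b ℚᵘ.≤ mkℚᵘ (+ c) d → + a / suc b ℚ.≤ + c / suc d
  normalise p≤q =
    ℚ.toℚᵘ-cancel-≤ (ℚᵘ.≤-respʳ-≃ (ℚᵘ.≃-sym (toℚᵘ-/ c d)) (ℚᵘ.≤-respˡ-≃ (ℚᵘ.≃-sym (toℚᵘ-/ a b)) p≤q))
  crossMultiply : mkℚᵘ (+ a) b ℚᵘ.≤ mkℚᵘ (+ c) d → a * suc d ≤ c * suc b
  crossMultiply (*≤* le) = ℤ.drop‿+≤+ (subst₂ ℤ._≤_ (sym (ℤ.pos-* a (suc d))) (sym (ℤ.pos-* c (suc b))) le)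
  uncross : a * suc d ≤ c * suc b → mkℚᵘ (+ a) b ℚᵘ.≤ mkℚᵘ (+ c) d
  uncross le = *≤* (subst₂ ℤ._≤_ (ℤ.pos-* a (suc d)) (ℤ.pos-* c (suc b)) (+≤+ le))

orderedLogConcaveAt⇔ : ∀ j a b c →
  ((1ℚ ℚ.+ + 1 / suc j) ℚ.* ((+ a / 1) ℚ.* (+ c / 1)) ℚ.≤ (+ b / 1) ℚ.* (+ b / 1))
    ⇔ (suc (suc j) * (a * c) ≤ suc j * (b * b))
-- Denominators stay the unsimplified products produced by /-+-/ and /-*-/: simplifying them
-- would mean rewriting under the NonZero instance argument of _/_.
orderedLogConcaveAt⇔ j a b c = begin
  (1ℚ ℚ.+ + 1 / suc j) ℚ.* ((+ a / 1) ℚ.* (+ c / 1)) ℚ.≤ (+ b / 1) ℚ.* (+ b / 1)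
    ≡⟨ cong₂ ℚ._≤_ lhs≡ (/-*-/ b b 1 1) ⟩
  + numerator / (1 * suc j * (1 * 1)) ℚ.≤ + (b * b) / (1 * 1)
    ∼⟨ /-≤-/ numerator (b * b) (1 * suc j * (1 * 1)) (1 * 1) ⟩
  numerator * (1 * 1) ≤ b * b * (1 * suc j * (1 * 1))
    ≡⟨ cong₂ _≤_ left right ⟩
  suc (suc j) * (a * c) ≤ suc j * (b * b) ∎
  where
  open Related.EquationalReasoning
  open +-*-Solver
  numerator : ℕ
  numerator = (1 * suc j + 1 * 1) * (a * c)
  lhs≡ : (1ℚ ℚ.+ + 1 / suc j) ℚ.* ((+ a / 1) ℚ.* (+ c / 1)) ≡ + numerator / (1 * suc j * (1 * 1))
  lhs≡ = trans (cong₂ ℚ._*_ (/-+-/ 1 1 1 (suc j)) (/-*-/ a c 1 1))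
               (/-*-/ (1 * suc j + 1 * 1) (a * c) (1 * suc j) (1 * 1))
  left : numerator * (1 * 1) ≡ suc (suc j) * (a * c)
  left = solve 2 (λ j x → (con 1 :* (con 1 :+ j) :+ con 1 :* con 1) :* x :* (con 1 :* con 1) := (con 2 :+ j) :* x)
           refl j (a * c)
  right : b * b * (1 * suc j * (1 * 1)) ≡ suc j * (b * b)
  right = solve 2 (λ j y → y :* (con 1 :* (con 1 :+ j) :* (con 1 :* con 1)) := (con 1 :+ j) :* y) refl j (b * b)

ratio-≤⇔ : ∀ a c {m n} → 0 < m → 0 < n → (ratio a m ℚ.≤ ratio c n) ⇔ (a * n ≤ c * m)
ratio-≤⇔ a c {suc b} {suc d} _ _ = /-≤-/ a c (suc b) (suc d)

suc≤∸1⇔< : ∀ {m} n → suc m ≤ n ∸ 1 ⇔ suc m < n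
suc≤∸1⇔< zero    = mk⇔ (λ ()) (λ ())
suc≤∸1⇔< (suc n) = mk⇔ s≤s ℕ.≤-pred

Independent : ∀ {n} → Graph n → Subset n → Set
Independent G S = ∀ {u w} → u ∈ S → w ∈ S → adj G u w ≡ false

IsolatedFrom : ∀ {n} → Graph n → Subset n → Fin n → Set
IsolatedFrom G S v = ∀ {u} → u ∈ S → adj G u v ≡ false

isIsolatedFrom : ∀ {n} → Graph n → Subset n → Fin n → Bool
isIsolatedFrom {n} G S v = not (any (λ u → (u ∈ᵇ S) ∧ adj G u v) (allFin n))

canExtend : ∀ {n} → Graph n → Subset n → Fin n → Bool
canExtend G S v = not (v ∈ᵇ S) ∧ isIsolatedFrom G S v

isIndependentOfSize : ∀ {n} → Graph n → ℕ → Subset n → Bool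
isIndependentOfSize G k S = isIndependent G S ∧ does (∣ S ∣ ℕ.≟ k)

module _ {n} (G : Graph n) where

  isIndependent⇔ : ∀ {S} → T (isIndependent G S) ⇔ Independent G S
  isIndependent⇔ {S} = mk⇔
    (λ ind {u} {w} u∈S w∈S → to T-not-∧∧ (pairwise ind u w) (from ∈ᵇ⇔∈ u∈S) (from ∈ᵇ⇔∈ w∈S))
    (λ ind → from (T-all-allFin (λ u → all (nonEdge u) (allFin n))) λ u → from (T-all-allFin (nonEdge u)) λ w →
       from (T-not-∧∧ {u ∈ᵇ S} {w ∈ᵇ S}) λ u∈S w∈S → ind (to ∈ᵇ⇔∈ u∈S) (to ∈ᵇ⇔∈ w∈S))
    where
    nonEdge : Fin n → Fin n → Bool
    nonEdge u w = not ((u ∈ᵇ S) ∧ (w ∈ᵇ S) ∧ adj G u w)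
    pairwise : T (isIndependent G S) → ∀ u w → T (nonEdge u w)
    pairwise ind u w = to (T-all-allFin (nonEdge u)) (to (T-all-allFin (λ u → all (nonEdge u) (allFin n))) ind u) w

  isIsolatedFrom⇔ : ∀ {S v} → T (isIsolatedFrom G S v) ⇔ IsolatedFrom G S v
  isIsolatedFrom⇔ {S} {v} = mk⇔ isolated (λ iso → from T-not⇔¬T (noNeighbour iso))
    where
    neighbourIn : Fin n → Bool
    neighbourIn u = (u ∈ᵇ S) ∧ adj G u v
    isolated : T (isIsolatedFrom G S v) → IsolatedFrom G S v
    isolated iso {u} u∈S with adj G u v in uv
    ... | false = refl
    ... | true  = ⊥-elim (to T-not⇔¬T iso (any⁺ neighbourIn (lose (∈-allFin u)
                    (from Bool.T-∧ (from ∈ᵇ⇔∈ u∈S , subst T (sym uv) tt)))))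
    noNeighbour : IsolatedFrom G S v → ¬ T (any neighbourIn (allFin n))
    noNeighbour iso some with satisfied (any⁻ neighbourIn (allFin n) some)
    ... | u , u∼v with to Bool.T-∧ u∼v
    ...   | u∈S , adj-uv = subst T (iso (to ∈ᵇ⇔∈ u∈S)) adj-uv

  Independent-⊆ : ∀ {S′ S} → S′ ⊆ S → Independent G S → Independent G S′
  Independent-⊆ S′⊆S ind u∈S′ w∈S′ = ind (S′⊆S u∈S′) (S′⊆S w∈S′)

  Independent-removal : ∀ {S v} → v ∈ S →
    Independent G S ⇔ (Independent G (S [ v ]≔ outside) × IsolatedFrom G (S [ v ]≔ outside) v)
  Independent-removal {S} {v} v∈S = mk⇔ remove reinsert
    where
    remove : Independent G S → Independent G (S [ v ]≔ outside) × IsolatedFrom G (S [ v ]≔ outside) v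
    remove ind = (λ u∈S⁻ w∈S⁻ → ind (proj₂ (∈-removal⁻ u∈S⁻)) (proj₂ (∈-removal⁻ w∈S⁻)))
               , (λ u∈S⁻ → ind (proj₂ (∈-removal⁻ u∈S⁻)) v∈S)
    reinsert : Independent G (S [ v ]≔ outside) × IsolatedFrom G (S [ v ]≔ outside) v → Independent G S
    reinsert (ind⁻ , iso) {u} {w} u∈S w∈S with u Fin.≟ v | w Fin.≟ v
    ... | yes refl | yes refl = irrefl G u
    ... | yes refl | no w≢v   = trans (Graph.sym G u w) (iso (∈-removal⁺ w≢v w∈S))
    ... | no u≢v   | yes refl = iso (∈-removal⁺ u≢v u∈S)
    ... | no u≢v   | no w≢v   = ind⁻ (∈-removal⁺ u≢v u∈S) (∈-removal⁺ w≢v w∈S)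

  isIndependent-removal : ∀ {S v} → v ∈ S →
    isIndependent G S ≡ isIndependent G (S [ v ]≔ outside) ∧ isIsolatedFrom G (S [ v ]≔ outside) v
  isIndependent-removal {S} {v} v∈S = T-injective (begin
    T (isIndependent G S)                                          ∼⟨ isIndependent⇔ ⟩
    Independent G S                                                ∼⟨ Independent-removal v∈S ⟩
    (Independent G S⁻ × IsolatedFrom G S⁻ v)                       ∼⟨ ⇔-sym (isIndependent⇔ ×-cong isIsolatedFrom⇔) ⟩
    (T (isIndependent G S⁻) × T (isIsolatedFrom G S⁻ v))           ∼⟨ ⇔-sym Bool.T-∧ ⟩
    T (isIndependent G S⁻ ∧ isIsolatedFrom G S⁻ v)                 ∎)
    where
    open Related.EquationalReasoning
    S⁻ : Subset n
    S⁻ = S [ v ]≔ outside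

  isIndependentOfSize-removal : ∀ {S v} k → v ∈ S →
    isIndependentOfSize G k (S [ v ]≔ outside) ∧ isIsolatedFrom G (S [ v ]≔ outside) v
      ≡ isIndependentOfSize G (suc k) S
  isIndependentOfSize-removal {S} {v} k v∈S = begin
    (isIndependent G S⁻ ∧ does (∣ S⁻ ∣ ℕ.≟ k)) ∧ isIsolatedFrom G S⁻ v
      ≡⟨ xy∙z≈xz∙y (isIndependent G S⁻) _ _ ⟩
    (isIndependent G S⁻ ∧ isIsolatedFrom G S⁻ v) ∧ does (∣ S⁻ ∣ ℕ.≟ k)
      ≡⟨ cong₂ _∧_ (sym (isIndependent-removal v∈S)) (cong (λ m → does (m ℕ.≟ suc k)) (sym (∣∣-removal v∈S))) ⟩
    isIndependent G S ∧ does (∣ S ∣ ℕ.≟ suc k) ∎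
    where
    open ≡-Reasoning
    S⁻ : Subset n
    S⁻ = S [ v ]≔ outside

  ∑-indSetsOfSize : ∀ k (f : Subset n → ℕ) →
    ∑ (indSetsOfSize G k) f ≡ ∑[ S ∈ allSubsets n ] ([ isIndependentOfSize G k S ] * f S)
  ∑-indSetsOfSize k f = begin
    ∑ (indSetsOfSize G k) f
      ≡⟨ ∑-filter (λ S → ∣ S ∣ ℕ.≟ k) (independentSets G) f ⟩
    ∑[ S ∈ independentSets G ] ([ does (∣ S ∣ ℕ.≟ k) ] * f S)
      ≡⟨ ∑-filter (λ S → isIndependent G S Bool.≟ true) (allSubsets n) _ ⟩
    ∑[ S ∈ allSubsets n ] ([ does (isIndependent G S Bool.≟ true) ] * ([ does (∣ S ∣ ℕ.≟ k) ] * f S))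
      ≡⟨ ∑-cong (allSubsets n) (λ S → merge (isIndependent G S) (does (∣ S ∣ ℕ.≟ k)) (f S)) ⟩
    ∑[ S ∈ allSubsets n ] ([ isIndependentOfSize G k S ] * f S) ∎
    where
    open ≡-Reasoning
    merge : ∀ b c x → [ does (b Bool.≟ true) ] * ([ c ] * x) ≡ [ b ∧ c ] * x
    merge b c x rewrite does-≟-true b | [∧] b c = sym (ℕ.*-assoc [ b ] [ c ] x)

  indCount≡∑ : ∀ k → indCount G k ≡ ∑[ S ∈ allSubsets n ] [ isIndependentOfSize G k S ]
  indCount≡∑ k = trans (length≡∑ (indSetsOfSize G k))
    (trans (∑-indSetsOfSize k (λ _ → 1)) (∑-cong (allSubsets n) (λ S → ℕ.*-identityʳ _)))

  ext≡∑ : ∀ S → ext G S ≡ ∑[ v ∈ allFin n ] [ canExtend G S v ]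
  ext≡∑ S = trans (length≡∑ (filter canExtend? (allFin n))) (trans (∑-filter canExtend? (allFin n) (λ _ → 1))
    (∑-cong (allFin n) (λ v → trans (ℕ.*-identityʳ _) (cong [_] (does-≟-true (canExtend G S v))))))
    where
    canExtend? : ∀ v → Dec (canExtend G S v ≡ true)
    canExtend? v = canExtend G S v Bool.≟ true

  pointedIndCount : ℕ → ℕ
  pointedIndCount k = ∑[ v ∈ allFin n ] ∑[ S ∈ allSubsets n ] [ v ∈ᵇ S ∧ isIndependentOfSize G k S ]

  pointedIndCount≡ : ∀ k → pointedIndCount k ≡ k * indCount G k
  pointedIndCount≡ k = begin
    pointedIndCount k
      ≡⟨ ∑-comm (allFin n) (allSubsets n) _ ⟩
    ∑[ S ∈ allSubsets n ] ∑[ v ∈ allFin n ] [ v ∈ᵇ S ∧ isIndependentOfSize G k S ]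
      ≡⟨ ∑-cong (allSubsets n) pointsOf ⟩
    ∑[ S ∈ allSubsets n ] (k * [ isIndependentOfSize G k S ])
      ≡⟨ ∑-*ˡ k (allSubsets n) _ ⟨
    k * ∑[ S ∈ allSubsets n ] [ isIndependentOfSize G k S ]
      ≡⟨ cong (k *_) (indCount≡∑ k) ⟨
    k * indCount G k ∎
    where
    open ≡-Reasoning
    indₖ : Subset n → Bool
    indₖ = isIndependentOfSize G k
    sizeWeight : ∀ b m → [ b ∧ does (m ℕ.≟ k) ] * m ≡ k * [ b ∧ does (m ℕ.≟ k) ]
    sizeWeight false m = sym (ℕ.*-zeroʳ k)
    sizeWeight true  m with m ≡ᵇ k in m≡ᵇk
    ... | true  = trans (ℕ.*-identityˡ m) (trans (ℕ.≡ᵇ⇒≡ m k (subst T (sym m≡ᵇk) tt)) (sym (ℕ.*-identityʳ k)))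
    ... | false = sym (ℕ.*-zeroʳ k)
    pointsOf : ∀ S → ∑[ v ∈ allFin n ] [ v ∈ᵇ S ∧ indₖ S ] ≡ k * [ indₖ S ]
    pointsOf S = begin
      ∑[ v ∈ allFin n ] [ v ∈ᵇ S ∧ indₖ S ]
        ≡⟨ ∑-cong (allFin n) (λ v → trans (cong [_] (Bool.∧-comm (v ∈ᵇ S) (indₖ S))) ([∧] (indₖ S) (v ∈ᵇ S))) ⟩
      ∑[ v ∈ allFin n ] ([ indₖ S ] * [ v ∈ᵇ S ])
        ≡⟨ ∑-*ˡ [ indₖ S ] (allFin n) (λ v → [ v ∈ᵇ S ]) ⟨
      [ indₖ S ] * ∑[ v ∈ allFin n ] [ v ∈ᵇ S ]
        ≡⟨ cong ([ indₖ S ] *_) (∣∣≡∑ S) ⟨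
      [ indₖ S ] * ∣ S ∣
        ≡⟨ sizeWeight (isIndependent G S) ∣ S ∣ ⟩
      k * [ indₖ S ] ∎

  ∑-ext≡pointedIndCount : ∀ k → ∑ (indSetsOfSize G k) (ext G) ≡ pointedIndCount (suc k)
  ∑-ext≡pointedIndCount k = begin
    ∑ (indSetsOfSize G k) (ext G)
      ≡⟨ ∑-indSetsOfSize k (ext G) ⟩
    ∑[ S ∈ allSubsets n ] ([ indₖ S ] * ext G S)
      ≡⟨ ∑-cong (allSubsets n) (λ S → trans (cong ([ indₖ S ] *_) (ext≡∑ S))
                                            (∑-*ˡ [ indₖ S ] (allFin n) (λ v → [ canExtend G S v ]))) ⟩
    ∑[ S ∈ allSubsets n ] ∑[ v ∈ allFin n ] ([ indₖ S ] * [ canExtend G S v ])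
      ≡⟨ ∑-comm (allSubsets n) (allFin n) _ ⟩
    ∑[ v ∈ allFin n ] ∑[ S ∈ allSubsets n ] ([ indₖ S ] * [ canExtend G S v ])
      ≡⟨ ∑-cong (allFin n) (λ v → ∑-cong (allSubsets n) (λ S → regroup (indₖ S) (not (v ∈ᵇ S)) _)) ⟩
    ∑[ v ∈ allFin n ] ∑[ S ∈ allSubsets n ] [ not (v ∈ᵇ S) ∧ extendable v S ]
      ≡⟨ ∑-cong (allFin n) (λ v → ∑-removal v (extendable v)) ⟩
    ∑[ v ∈ allFin n ] ∑[ S ∈ allSubsets n ] [ v ∈ᵇ S ∧ extendable v (S [ v ]≔ outside) ]
      ≡⟨ ∑-cong (allFin n) (λ v → ∑-cong (allSubsets n) (λ S → cong [_] (reinsert v S))) ⟩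
    pointedIndCount (suc k) ∎
    where
    open ≡-Reasoning
    indₖ : Subset n → Bool
    indₖ = isIndependentOfSize G k
    extendable : Fin n → Subset n → Bool
    extendable v S = indₖ S ∧ isIsolatedFrom G S v
    regroup : ∀ a b c → [ a ] * [ b ∧ c ] ≡ [ b ∧ (a ∧ c) ]
    regroup a b c = trans (sym ([∧] a (b ∧ c))) (cong [_] (x∙yz≈y∙xz a b c))
    reinsert : ∀ v S → v ∈ᵇ S ∧ extendable v (S [ v ]≔ outside) ≡ v ∈ᵇ S ∧ isIndependentOfSize G (suc k) S
    reinsert v S with v ∈ᵇ S in v∈ᵇS
    ... | false = refl
    ... | true  = isIndependentOfSize-removal {S} {v} k (to ∈ᵇ⇔∈ (subst T (sym v∈ᵇS) tt))

  ∑-ext≡ : ∀ k → ∑ (indSetsOfSize G k) (ext G) ≡ suc k * indCount G (suc k)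
  ∑-ext≡ k = trans (∑-ext≡pointedIndCount k) (pointedIndCount≡ (suc k))

  independentSet-≥ : ∀ {k} → k ≤ independenceNumber G → ∃[ S ] Independent G S × k ≤ ∣ S ∣
  independentSet-≥ k≤α with ≤-foldr-⊔⁻ ∣_∣ (independentSets G) k≤α
  ... | inj₁ refl              = ⊥ , (λ u∈⊥ _ → ⊥-elim (∉⊥ u∈⊥)) , z≤n
  ... | inj₂ (S , S∈ , k≤∣S∣) =
    S , to isIndependent⇔ (from Bool.T-≡ (proj₂ (∈-filter⁻ isIndependent? {xs = allSubsets n} S∈))) , k≤∣S∣
    where
    isIndependent? : ∀ S → Dec (isIndependent G S ≡ true)
    isIndependent? S = isIndependent G S Bool.≟ true

  indCount-pos : ∀ k → k ≤ independenceNumber G → 0 < indCount G k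
  indCount-pos k k≤α with independentSet-≥ k≤α
  ... | S , indS , k≤∣S∣ with ⊆-ofSize k S k≤∣S∣
  ...   | S′ , S′⊆S , ∣S′∣≡k = filter-some (λ S → ∣ S ∣ ℕ.≟ k) (lose S′∈ ∣S′∣≡k)
    where
    S′∈ : S′ ∈ˡ independentSets G
    S′∈ = ∈-filter⁺ (λ S → isIndependent G S Bool.≟ true) (∈-allSubsets S′)
            (to Bool.T-≡ (from isIndependent⇔ (Independent-⊆ S′⊆S indS)))

  orderedLogConcaveAt⇔eAvg≤ : ∀ j → suc j < independenceNumber G →
    ((1ℚ ℚ.+ + 1 / suc j) ℚ.* ((+ indCount G j / 1) ℚ.* (+ indCount G (suc (suc j)) / 1))
       ℚ.≤ (+ indCount G (suc j) / 1) ℚ.* (+ indCount G (suc j) / 1))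
      ⇔ (eAvg G (suc j) ℚ.≤ eAvg G j)
  orderedLogConcaveAt⇔eAvg≤ j j+1<α = begin
    (1ℚ ℚ.+ + 1 / suc j) ℚ.* ((+ i₀ / 1) ℚ.* (+ i₂ / 1)) ℚ.≤ (+ i₁ / 1) ℚ.* (+ i₁ / 1)
      ∼⟨ orderedLogConcaveAt⇔ j i₀ i₁ i₂ ⟩
    suc (suc j) * (i₀ * i₂) ≤ suc j * (i₁ * i₁)
      ≡⟨ cong₂ _≤_ (trans (cong (suc (suc j) *_) (ℕ.*-comm i₀ i₂)) (sym (ℕ.*-assoc (suc (suc j)) i₂ i₀)))
                   (sym (ℕ.*-assoc (suc j) i₁ i₁)) ⟩
    suc (suc j) * i₂ * i₀ ≤ suc j * i₁ * i₁
      ∼⟨ ⇔-sym (ratio-≤⇔ (suc (suc j) * i₂) (suc j * i₁) (indCount-pos (suc j) (ℕ.<⇒≤ j+1<α))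
                                                       (indCount-pos j (ℕ.≤-trans (ℕ.n≤1+n j) (ℕ.<⇒≤ j+1<α)))) ⟩
    ratio (suc (suc j) * i₂) i₁ ℚ.≤ ratio (suc j * i₁) i₀
      ≡⟨ cong₂ ℚ._≤_ (cong (λ s → ratio s i₁) (∑-ext≡ (suc j))) (cong (λ s → ratio s i₀) (∑-ext≡ j)) ⟨
    eAvg G (suc j) ℚ.≤ eAvg G j ∎
    where
    open Related.EquationalReasoning
    i₀ i₁ i₂ : ℕ
    i₀ = indCount G j
    i₁ = indCount G (suc j)
    i₂ = indCount G (suc (suc j))

claim1p9 : ∀ {n : ℕ} (G : Graph n) →
    OrderedLogConcave (indCount G) (independenceNumber G)
      ⇔ WeaklyDecreasing (eAvg G) (independenceNumber G ∸ 1)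
claim1p9 G = mk⇔
  (λ (_ , logConcave) k k+1≤α∸1 →
     let k+1<α = to (suc≤∸1⇔< (independenceNumber G)) k+1≤α∸1
     in to (orderedLogConcaveAt⇔eAvg≤ G k k+1<α) (logConcave k k+1<α))
  (λ decreasing → indCount-pos G , λ j j+1<α →
     from (orderedLogConcaveAt⇔eAvg≤ G j j+1<α) (decreasing j (from (suc≤∸1⇔< (independenceNumber G)) j+1<α)))
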